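{- Let $G$ be a mixed graph with maximum undirected degree $\Delta=1$. Then, for every even $\ell\ge 2$, the sequence mixed graph $S^{\ell}(G)$ is isomorphic to the $\ell$-iterated line digraph $L^{\ell}(G)$ (of $G$ viewed as the digraph $G^*$), provided that the edges of $S^{\ell}(G)$ are mapped to the digons (pairs of opposite arcs) of $L^{\ell}(G)$.
   Context: A mixed graph $G$ has (undirected) edges and (directed) arcs, with no loops; it is identified with its associated digraph $G^*$ obtained by replacing each edge by two opposite arcs (a digon). The undirected degree of a vertex is the number of edges incident to it. A walk of length $\ell$ is a sequence $u_0u_1\dots u_\ell$ such that each $(u_{i-1},u_i)$ is an edge or an arc from $u_{i-1}$ to $u_i$; it is undirected if it uses only edges; its conjugate is $u_\ell\dots u_0$. For a digraph $D$, the $\ell$-iterated line digraph $L^{\ell}(D)$ has as vertices the walks $u_0\dots u_\ell$ of length $\ell$ in $D$, with an arc from $u_0u_1\dots u_\ell$ to each $u_1\dots u_\ell u_{\ell+1}$ such that $(u_\ell,u_{\ell+1})$ is an arc of $D$. The sequence mixed graph $S^{\ell}(G)$: its vertices are the walks of length $\ell$ of $G$, where a walk and its conjugate are regarded as the same vertex if and only if the walk is undirected. For distinct vertices $\mathbf{x},\mathbf{y}$, there is an adjacency from $\mathbf{x}$ to $\mathbf{y}$ if there is a walk $u_0u_1\dots u_{\ell+1}$ in $G$ with $u_0\dots u_\ell$ representing $\mathbf{x}$ and $u_1\dots u_{\ell+1}$ representing $\mathbf{y}$; it is an edge if such a walk uses only edges of $G$, and an arc from $\mathbf{x}$ to $\mathbf{y}$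 otherwise. Loops are not considered. -}

module Defs where

open import Data.Nat using (ℕ; zero; suc; _≤_)
open import Data.Fin using (Fin)
open import Data.Bool using (Bool; T; _∨_)
open import Data.Unit using (⊤)
open import Data.Empty using (⊥)
open import Data.Product using (Σ; ∃; _×_; proj₁)
open import Data.Sum using (_⊎_)
open import Data.List using (length; filterᵇ; allFin)
open import Data.Vec using (Vec; []; _∷_; tail; reverse)
open import Relation.Nullary using (¬_)
open import Relation.Binary.PropositionalEquality using (_≡_)
open import Function.Bundles using (_⇔_)

record MixedGraph (n : ℕ) : Set where
  field
    edge        : Fin n → Fin n → Bool
    arc         : Fin n → Fin n → Bool
    edge-sym    : ∀ u v → T (edge u v) → T (edge v u)
    edge-irrefl : ∀ u → ¬ T (edge u u)
    arc-irrefl  : ∀ u → ¬ T (arc u u)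
    edge-arc    : ∀ u v → T (edge u v) → ¬ T (arc u v)

module _ {n : ℕ} (G : MixedGraph n) where
  open MixedGraph G

  -- adjacency in the associated digraph G* (edges become digons)
  adj : Fin n → Fin n → Bool
  adj u v = edge u v ∨ arc u v

  udeg : Fin n → ℕ
  udeg u = length (filterᵇ (edge u) (allFin n))

  MaxUDeg≡1 : Set
  MaxUDeg≡1 = (∀ u → udeg u ≤ 1) × ∃ (λ u → udeg u ≡ 1)

  IsWalk : ∀ {k} → Vec (Fin n) k → Set
  IsWalk []           = ⊤
  IsWalk (x ∷ [])     = ⊤
  IsWalk (x ∷ y ∷ xs) = T (adj x y) × IsWalk (y ∷ xs)

  IsUndirected : ∀ {k} → Vec (Fin n) k → Set
  IsUndirected []           = ⊤
  IsUndirected (x ∷ [])     = ⊤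
  IsUndirected (x ∷ y ∷ xs) = T (edge x y) × IsUndirected (y ∷ xs)

dropLast : ∀ {A : Set} {k} → Vec A (suc k) → Vec A k
dropLast (x ∷ [])     = []
dropLast (x ∷ y ∷ xs) = x ∷ dropLast (y ∷ xs)

module Seq {n : ℕ} (G : MixedGraph n) (ℓ : ℕ) where

  -- walks of length ℓ (vertices of L^ℓ(G*), representatives of vertices of S^ℓ(G))
  Walk : Set
  Walk = Σ (Vec (Fin n) (suc ℓ)) (IsWalk G)

  -- "x and y represent the same vertex of S^ℓ(G)": equal, or x is undirected
  -- and y is its conjugate
  _≈S_ : Vec (Fin n) (suc ℓ) → Vec (Fin n) (suc ℓ) → Set
  x ≈S y = x ≡ y ⊎ (IsUndirected G x × y ≡ reverse x)

  SWalkFromTo : Vec (Fin n) (suc ℓ) → Vec (Fin n) (suc ℓ) → Set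
  SWalkFromTo x y = ∃ λ (w : Vec (Fin n) (suc (suc ℓ))) →
    IsWalk G w × dropLast w ≈S x × tail w ≈S y

  SUWalkFromTo : Vec (Fin n) (suc ℓ) → Vec (Fin n) (suc ℓ) → Set
  SUWalkFromTo x y = ∃ λ (w : Vec (Fin n) (suc (suc ℓ))) →
    IsUndirected G w × dropLast w ≈S x × tail w ≈S y

  SEdge : Walk → Walk → Set
  SEdge x y = ¬ (proj₁ x ≈S proj₁ y) × SUWalkFromTo (proj₁ x) (proj₁ y)

  SArc : Walk → Walk → Set
  SArc x y = ¬ (proj₁ x ≈S proj₁ y) × SWalkFromTo (proj₁ x) (proj₁ y)
             × ¬ SUWalkFromTo (proj₁ x) (proj₁ y)

  -- adjacency x → y in the associated digraph S^ℓ(G)* (edges replaced by digons)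
  SAdj* : Walk → Walk → Set
  SAdj* x y = SEdge x y ⊎ SArc x y

  LArc : Walk → Walk → Set
  LArc x y = ∃ λ (w : Vec (Fin n) (suc (suc ℓ))) →
    IsWalk G w × dropLast w ≡ proj₁ x × tail w ≡ proj₁ y

  -- an isomorphism from S^ℓ(G) to L^ℓ(G*) mapping edges of S^ℓ(G) to digons,
  -- i.e. a digraph isomorphism S^ℓ(G)* ≅ L^ℓ(G*); vertices of S^ℓ(G) are
  -- ≈S-classes of walks, so φ must respect ≈S and be injective on classes.
  record SeqLineIso : Set where
    field
      φ       : Walk → Walk
      φ-resp  : ∀ x y → proj₁ x ≈S proj₁ y → proj₁ (φ x) ≡ proj₁ (φ y)
      φ-inj   : ∀ x y → proj₁ (φ x) ≡ proj₁ (φ y) → proj₁ x ≈S proj₁ y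
      φ-surj  : ∀ (z : Walk) → ∃ λ (x : Walk) → proj₁ (φ x) ≡ proj₁ z
      φ-adj   : ∀ x y → SAdj* x y ⇔ LArc (φ x) (φ y)

-- When every vertex has at most one undirected neighbour, an undirected walk
-- can only bounce back and forth along a single edge: it is a b a b … .  For
-- even ℓ such a walk has an odd number of entries, so it begins and ends at the
-- same vertex and equals its own conjugate.  Hence identifying an undirected
-- walk with its conjugate identifies nothing, and the vertices of S^ℓ(G) are
-- exactly those of L^ℓ(G*).  A walk of length ℓ + 1 witnessing an adjacency is
-- then determined by its two ends, so it is undirected exactly when the
-- adjacency of S^ℓ(G) is an edge, and the identity map is the isomorphism.
module Submission where

open import Defs
open import Data.Nat using (ℕ; zero; suc; _*_; _≤_; s≤s)
open import Data.Nat.Divisibility using (_∣_; divides)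
open import Data.Fin using (Fin)
open import Data.Bool using (T)
open import Data.Bool.Properties using (T-∨)
open import Data.Unit using (tt)
open import Data.Product using (_,_; proj₁)
open import Data.Sum using (inj₁; inj₂)
open import Data.List using (List; []; _∷_; length; filterᵇ; allFin)
open import Data.List.Relation.Unary.Any using (here)
open import Data.List.Membership.Propositional using (_∈_)
open import Data.List.Membership.Propositional.Properties using (∈-allFin; ∈-filter⁺)
open import Data.Vec using (Vec; []; _∷_; head; tail; reverse; _∷ʳ_)
open import Data.Vec.Properties using (reverse-∷)
open import Relation.Nullary using (¬_; Dec; yes; no)
open import Relation.Nullary.Decidable using (_×-dec_)
open import Relation.Nullary.Decidable.Core using (T?)
open import Relation.Binary.PropositionalEquality
open import Function using (id; _∘_)
open import Function.Bundles using (_⇔_; mk⇔; Equivalence)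

∈-length≤1-unique : ∀ {A : Set} {a b : A} {xs : List A} →
                    length xs ≤ 1 → a ∈ xs → b ∈ xs → a ≡ b
∈-length≤1-unique {xs = _ ∷ []}    _        (here refl) (here refl) = refl
∈-length≤1-unique {xs = _ ∷ _ ∷ _} (s≤s ()) _           _

dropLast-tail-injective : ∀ {A : Set} {k} (v w : Vec A (suc (suc k))) →
                          dropLast v ≡ dropLast w → tail v ≡ tail w → v ≡ w
dropLast-tail-injective (a ∷ _ ∷ _) (b ∷ _ ∷ _) dv≡dw refl with cong head dv≡dw
... | refl = refl

alternate : ∀ {A : Set} → A → A → (k : ℕ) → Vec A (suc k)
alternate a b zero    = a ∷ []
alternate a b (suc k) = a ∷ alternate b a k

alternate-even-∷ʳ : ∀ {A : Set} (a b : A) q →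
                    alternate a b (q * 2) ∷ʳ b ∷ʳ a ≡ a ∷ b ∷ alternate a b (q * 2)
alternate-even-∷ʳ a b zero    = refl
alternate-even-∷ʳ a b (suc q) = cong (λ v → a ∷ b ∷ v) (alternate-even-∷ʳ a b q)

reverse-alternate-even : ∀ {A : Set} (a b : A) q →
                         reverse (alternate a b (q * 2)) ≡ alternate a b (q * 2)
reverse-alternate-even a b zero    = refl
reverse-alternate-even a b (suc q) = begin
  reverse (a ∷ b ∷ v)   ≡⟨ reverse-∷ a (b ∷ v) ⟩
  reverse (b ∷ v) ∷ʳ a  ≡⟨ cong (_∷ʳ a) (reverse-∷ b v) ⟩
  reverse v ∷ʳ b ∷ʳ a   ≡⟨ cong (λ u → u ∷ʳ b ∷ʳ a) (reverse-alternate-even a b q) ⟩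
  v ∷ʳ b ∷ʳ a           ≡⟨ alternate-even-∷ʳ a b q ⟩
  a ∷ b ∷ v             ∎
  where
  open ≡-Reasoning
  v = alternate a b (q * 2)

module _ {n : ℕ} (G : MixedGraph n) where
  open MixedGraph G

  adj-irrefl : ∀ u → ¬ T (adj G u u)
  adj-irrefl u uu with Equivalence.to T-∨ uu
  ... | inj₁ uu-edge = edge-irrefl u uu-edge
  ... | inj₂ uu-arc  = arc-irrefl u uu-arc

  undirected⇒walk : ∀ {k} (w : Vec (Fin n) k) → IsUndirected G w → IsWalk G w
  undirected⇒walk []          _       = tt
  undirected⇒walk (_ ∷ [])    _       = tt
  undirected⇒walk (x ∷ y ∷ w) (e , u) = Equivalence.from T-∨ (inj₁ e) , undirected⇒walk (y ∷ w) u

  undirected? : ∀ {k} (w : Vec (Fin n) k) → Dec (IsUndirected G w)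
  undirected? []          = yes tt
  undirected? (_ ∷ [])    = yes tt
  undirected? (x ∷ y ∷ w) = T? (edge x y) ×-dec undirected? (y ∷ w)

  walk-dropLast≢tail : ∀ {k} (w : Vec (Fin n) (suc (suc k))) → IsWalk G w → dropLast w ≢ tail w
  walk-dropLast≢tail (a ∷ _ ∷ _) (ab , _) dw≡tw with cong head dw≡tw
  ... | refl = adj-irrefl a ab

  module _ (udeg≤1 : ∀ u → udeg G u ≤ 1) where

    edge-functional : ∀ {u a b} → T (edge u a) → T (edge u b) → a ≡ b
    edge-functional {u} ua ub =
      ∈-length≤1-unique (udeg≤1 u) (neighbour ua) (neighbour ub)
      where
      neighbour : ∀ {a} → T (edge u a) → a ∈ filterᵇ (edge u) (allFin n)
      neighbour ua = ∈-filter⁺ (T? ∘ edge u) (∈-allFin _) ua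

    undirected⇒alternate : ∀ {k} a b (xs : Vec (Fin n) k) →
                           IsUndirected G (a ∷ b ∷ xs) → a ∷ b ∷ xs ≡ alternate a b (suc k)
    undirected⇒alternate a b []       _                    = refl
    undirected⇒alternate a b (c ∷ xs) (ab , bc , bcxs) with edge-functional (edge-sym a b ab) bc
    ... | refl = cong (a ∷_) (undirected⇒alternate b a xs (bc , bcxs))

    undirected-even-palindrome : ∀ q (x : Vec (Fin n) (suc (q * 2))) →
                                 IsUndirected G x → reverse x ≡ x
    undirected-even-palindrome zero    (_ ∷ [])     _ = refl
    undirected-even-palindrome (suc q) (a ∷ b ∷ xs) u =
      subst (λ v → reverse v ≡ v) (sym (undirected⇒alternate a b xs u))
            (reverse-alternate-even a b (suc q))

    module _ (q : ℕ) where
      open Seq G (q * 2)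

      ≈S⇒≡ : ∀ {x y} → x ≈S y → x ≡ y
      ≈S⇒≡     (inj₁ x≡y)        = x≡y
      ≈S⇒≡ {x} (inj₂ (u , y≡rx)) = trans (sym (undirected-even-palindrome q x u)) (sym y≡rx)

      LArc⇒¬≈S : ∀ {x y} → LArc x y → ¬ (proj₁ x ≈S proj₁ y)
      LArc⇒¬≈S (w , wk , dw≡x , tw≡y) x≈y =
        walk-dropLast≢tail w wk (trans dw≡x (trans (≈S⇒≡ x≈y) (sym tw≡y)))

      SUWalk⇒undirected : ∀ {x y} (w : Vec (Fin n) (suc (suc (q * 2)))) →
                          dropLast w ≡ x → tail w ≡ y → SUWalkFromTo x y → IsUndirected G w
      SUWalk⇒undirected w dw≡x tw≡y (w′ , u′ , dw′≈x , tw′≈y) =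
        subst (IsUndirected G)
              (dropLast-tail-injective w′ w (trans (≈S⇒≡ dw′≈x) (sym dw≡x))
                                            (trans (≈S⇒≡ tw′≈y) (sym tw≡y)))
              u′

      SAdj*⇔LArc : ∀ x y → SAdj* x y ⇔ LArc x y
      SAdj*⇔LArc x y = mk⇔ to from
        where
        to : SAdj* x y → LArc x y
        to (inj₁ (_ , w , u , dw≈x , tw≈y))        = w , undirected⇒walk w u , ≈S⇒≡ dw≈x , ≈S⇒≡ tw≈y
        to (inj₂ (_ , (w , wk , dw≈x , tw≈y) , _)) = w , wk , ≈S⇒≡ dw≈x , ≈S⇒≡ tw≈y

        from : LArc x y → SAdj* x y
        from xy@(w , wk , dw≡x , tw≡y) with undirected? w
        ... | yes u = inj₁ (LArc⇒¬≈S {x} {y} xy , w , u , inj₁ dw≡x , inj₁ tw≡y)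
        ... | no ¬u = inj₂ (LArc⇒¬≈S {x} {y} xy , (w , wk , inj₁ dw≡x , inj₁ tw≡y) ,
                            ¬u ∘ SUWalk⇒undirected w dw≡x tw≡y)

      identity-SeqLineIso : SeqLineIso
      identity-SeqLineIso = record
        { φ      = id
        ; φ-resp = λ x y → ≈S⇒≡ {proj₁ x} {proj₁ y}
        ; φ-inj  = λ _ _ → inj₁
        ; φ-surj = λ z → z , refl
        ; φ-adj  = SAdj*⇔LArc
        }

corollary3p4 : ∀ {n : ℕ} (G : MixedGraph n) → MaxUDeg≡1 G →
    (ℓ : ℕ) → 2 ≤ ℓ → 2 ∣ ℓ → Seq.SeqLineIso G ℓ
corollary3p4 G (udeg≤1 , _) ℓ _ (divides q refl) = identity-SeqLineIso G udeg≤1 q
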